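{- Let $A$ and $B$ be density-1 reals with $B\subseteq A$. Then $B\geq_g A$.
   Context: Reals are subsets of $\mathbb{N}$; $n=\{0,\dots,n-1\}$; a real $A$ is density-1 if $\lim_{n\to\infty}|A\cap n|/n=1$. A partial oracle for a real $C$ is a set $(C)$ of triples $\langle n,x,l\rangle$ (coded as naturals, usable as a Turing oracle) such that $\langle n,0,l\rangle\in(C)$ implies $n\notin C$ and $\langle n,1,l\rangle\in(C)$ implies $n\in C$; $\mathrm{dom}((C))=\{n:\exists x,l\ \langle n,x,l\rangle\in(C)\}$. A generic oracle for $C$ is a partial oracle for $C$ with density-1 domain. $\varphi^X$ is a generic computation of $D$ if $\mathrm{dom}(\varphi^X)$ is density-1, $\varphi^X$ has values in $\{0,1\}$, and agrees with $D$ on its domain. $C\geq_g D$ if there is a single Turing functional $\varphi$ such that for every generic oracle $(C)$ for $C$, $\varphi^{(C)}$ is a generic computation of $D$. -}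

module Defs where

open import Data.Nat using (ℕ; zero; suc; _+_; _*_; _∸_; _≤_; _<_)
open import Data.Bool using (Bool; true; false; if_then_else_)
open import Data.Fin using (Fin)
open import Data.Vec using (Vec; []; _∷_; lookup)
open import Data.List using (List; length)
open import Data.List.Relation.Unary.All using (All)
open import Data.List.Relation.Unary.Unique.Propositional using (Unique)
open import Data.Product using (Σ; _×_)
open import Relation.Binary.PropositionalEquality using (_≡_)

-- Reals: subsets of ℕ, given by characteristic functions.
Real : Set
Real = ℕ → Bool

-- Cantor pairing ⟨a , b⟩ = (a+b)(a+b+1)/2 + b, and triples ⟨n,x,l⟩ = ⟨n,⟨x,l⟩⟩.
tri : ℕ → ℕ
tri zero    = zero
tri (suc n) = suc n + tri n

pair : ℕ → ℕ → ℕ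
pair a b = tri (a + b) + b

triple : ℕ → ℕ → ℕ → ℕ
triple n x l = pair n (pair x l)

-- Density 1 for an arbitrary predicate on ℕ:
-- for every k, eventually |P ∩ n| ≥ L with (n - L)(k+1) ≤ n,
-- i.e. |P ∩ n| / n ≥ 1 - 1/(k+1); witnessed by L distinct elements of P below n.
Density1 : (ℕ → Set) → Set
Density1 P =
  ∀ (k : ℕ) → Σ ℕ λ N → ∀ (n : ℕ) → N ≤ n →
    Σ (List ℕ) λ xs →
      Unique xs × All (λ m → (m < n) × P m) xs × ((n ∸ length xs) * suc k ≤ n)

_∈R_ : ℕ → Real → Set
n ∈R A = A n ≡ true

Density1Real : Real → Set
Density1Real A = Density1 (λ n → n ∈R A)

_⊆R_ : Real → Real → Set
B ⊆R A = ∀ n → n ∈R B → n ∈R A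

-- Turing functionals: Kleene's partial recursive functions relative to
-- an oracle X : ℕ → Bool (oracle query returns 1 if x ∈ X, else 0).

data PR : ℕ → Set where
  zer   : ∀ {k} → PR k
  succ  : PR 1
  proj  : ∀ {k} → Fin k → PR k
  orc   : PR 1
  comp  : ∀ {k m} → PR m → Vec (PR k) m → PR k
  prec  : ∀ {k} → PR k → PR (suc (suc k)) → PR (suc k)
  mu    : ∀ {k} → PR (suc k) → PR k

bit : Bool → ℕ
bit b = if b then 1 else 0

mutual
  data Eval (X : ℕ → Bool) : ∀ {k} → PR k → Vec ℕ k → ℕ → Set where
    ev-zer  : ∀ {k} {xs : Vec ℕ k} → Eval X zer xs 0
    ev-succ : ∀ {x} → Eval X succ (x ∷ []) (suc x)
    ev-proj : ∀ {k} {i : Fin k} {xs} → Eval X (proj i) xs (lookup xs i)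
    ev-orc  : ∀ {x} → Eval X orc (x ∷ []) (bit (X x))
    ev-comp : ∀ {k m} {f : PR m} {gs : Vec (PR k) m} {xs ys v} →
              EvalVec X gs xs ys → Eval X f ys v → Eval X (comp f gs) xs v
    ev-prec0 : ∀ {k} {g : PR k} {h : PR (suc (suc k))} {xs v} →
               Eval X g xs v → Eval X (prec g h) (0 ∷ xs) v
    ev-precS : ∀ {k} {g : PR k} {h : PR (suc (suc k))} {n xs r v} →
               Eval X (prec g h) (n ∷ xs) r → Eval X h (n ∷ r ∷ xs) v →
               Eval X (prec g h) (suc n ∷ xs) v
    ev-mu   : ∀ {k} {f : PR (suc k)} {xs n} →
              Eval X f (n ∷ xs) 0 →
              (∀ m → m < n → Σ ℕ λ v → Eval X f (m ∷ xs) (suc v)) →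
              Eval X (mu f) xs n

  data EvalVec (X : ℕ → Bool) {k : ℕ} : ∀ {m} → Vec (PR k) m → Vec ℕ k → Vec ℕ m → Set where
    evv-nil  : ∀ {xs} → EvalVec X [] xs []
    evv-cons : ∀ {m} {g : PR k} {gs : Vec (PR k) m} {xs y ys} →
               Eval X g xs y → EvalVec X gs xs ys → EvalVec X (g ∷ gs) xs (y ∷ ys)

TuringFunctional : Set
TuringFunctional = PR 1

_^_⟨_⟩≃_ : TuringFunctional → (ℕ → Bool) → ℕ → ℕ → Set
φ ^ X ⟨ n ⟩≃ v = Eval X φ (n ∷ []) v

-- O is a partial oracle for C (O a set of codes of triples ⟨n,x,l⟩, x ∈ {0,1}).
PartialOracle : Real → (ℕ → Bool) → Set
PartialOracle C O =
  (∀ n x l → triple n x l ∈R O → x ≤ 1) ×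
  (∀ n l → triple n 0 l ∈R O → C n ≡ false) ×
  (∀ n l → triple n 1 l ∈R O → C n ≡ true)

Dom : (ℕ → Bool) → ℕ → Set
Dom O n = Σ ℕ λ x → Σ ℕ λ l → triple n x l ∈R O

GenericOracle : Real → (ℕ → Bool) → Set
GenericOracle C O = PartialOracle C O × Density1 (Dom O)

GenericComputation : TuringFunctional → (ℕ → Bool) → Real → Set
GenericComputation φ X D =
  Density1 (λ n → Σ ℕ λ v → φ ^ X ⟨ n ⟩≃ v) ×
  (∀ n v → φ ^ X ⟨ n ⟩≃ v → v ≡ bit (D n))

_≥g_ : Real → Real → Set
C ≥g D = Σ TuringFunctional λ φ → ∀ (O : ℕ → Bool) → GenericOracle C O → GenericComputation φ O D

module Submission where

-- The reduction is the functional φ that, on input n, searches for an l with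
-- ⟨n,1,l⟩ in the oracle and outputs 1 when it finds one.  Given a generic
-- oracle O for B:
--   * φ^O(n) = 1 only if O asserts n ∈ B, and then n ∈ A; so φ^O never
--     disagrees with A.
--   * every n ∈ B ∩ dom(O) carries an entry ⟨n,1,l⟩ in O, so φ^O(n) halts.
--     Since density-1 sets are closed under (decidable) intersection and
--     under supersets, dom(φ^O) is density-1.
-- The file first proves the counting facts (a pigeonhole principle for
-- duplicate-free lists and deficit arithmetic), then the closure of density 1
-- under intersection and weakening, then programs φ ('search') as a partial
-- recursive functional and determines exactly when it halts and what it
-- outputs, and finally assembles the theorem.

open import Defs
open import Data.Nat using (ℕ; zero; suc; _+_; _*_; _∸_; _≤_; _<_; z≤n; s≤s; s≤s⁻¹; _⊔_; _<?_)
open import Data.Nat.Properties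
open import Data.Bool using (Bool; true; false)
open import Data.Bool.Properties using () renaming (_≟_ to _≟B_)
open import Data.Fin using () renaming (zero to fz; suc to fs)
open import Data.Vec using ([]; _∷_)
open import Data.List using (List; []; _∷_; length; filter; _++_)
open import Data.List.Properties using (length-++; filter-all)
open import Data.List.Relation.Unary.All as All using (All; []; _∷_)
import Data.List.Relation.Unary.All.Properties as All
open import Data.List.Relation.Unary.AllPairs using (_∷_)
open import Data.List.Relation.Unary.Unique.Propositional using (Unique)
import Data.List.Relation.Unary.Unique.Propositional.Properties as Unique
open import Data.List.Relation.Binary.Disjoint.Propositional using (Disjoint)
open import Data.Product using (Σ; _×_; _,_; proj₁; proj₂)
open import Data.Sum using (_⊎_; inj₁; inj₂)
open import Relation.Binary.PropositionalEquality
open import Relation.Nullary using (¬_; ¬?; yes; no; contradiction)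
open import Relation.Unary using (Decidable)
open import Function using (_∘_)

below-top : ∀ {n xs} → All (n ≢_) xs → All (_< suc n) xs → All (_< n) xs
below-top n≢xs xs<1+n =
  All.zipWith (λ (n≢y , y<1+n) → ≤∧≢⇒< (s≤s⁻¹ y<1+n) (n≢y ∘ sym)) (n≢xs , xs<1+n)

-- Among duplicate-free values below n+1, at most one is not below n.
-- (Stated for an arbitrary decision procedure so that it can be analysed by 'with'.)
at-most-one-top : ∀ n (_<n? : Decidable (_< n)) xs → Unique xs → All (_< suc n) xs →
                  length xs ≤ suc (length (filter _<n? xs))
at-most-one-top n _<n? [] _ _ = z≤n
at-most-one-top n _<n? (x ∷ xs) (x∉xs ∷ u) (x<1+n ∷ xs<1+n) with x <n?
... | yes _ = s≤s (at-most-one-top n _<n? xs u xs<1+n)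
... | no x≮n with refl ← ≤-antisym (s≤s⁻¹ x<1+n) (≮⇒≥ x≮n) =
  s≤s (≤-reflexive (sym (cong length (filter-all _<n? (below-top x∉xs xs<1+n)))))

pigeonhole : ∀ n xs → Unique xs → All (_< n) xs → length xs ≤ n
pigeonhole zero [] _ _ = z≤n
pigeonhole zero (_ ∷ _) _ (() ∷ _)
pigeonhole (suc n) xs u xs<1+n = ≤-trans (at-most-one-top n (_<? n) xs u xs<1+n)
  (s≤s (pigeonhole n (filter (_<? n) xs) (Unique.filter⁺ (_<? n) u) (All.all-filter (_<? n) xs)))

length-filter-split : ∀ {A : Set} {P : A → Set} (P? : Decidable P) xs →
                      length (filter P? xs) + length (filter (¬? ∘ P?) xs) ≡ length xs
length-filter-split P? [] = refl
length-filter-split P? (x ∷ xs) with P? x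
... | yes _ = cong suc (length-filter-split P? xs)
... | no _ = trans (+-suc _ _) (cong suc (length-filter-split P? xs))

-- Duplicate-free lists below n lying outside resp. inside Q are disjoint,
-- so together they have at most n elements.
separated-length : ∀ {Q : ℕ → Set} n ws ys → Unique ws → Unique ys →
                   All (λ m → m < n × ¬ Q m) ws → All (λ m → m < n × Q m) ys →
                   length ws + length ys ≤ n
separated-length n ws ys uw uy aw ay =
  subst (_≤ n) (length-++ ws)
    (pigeonhole n (ws ++ ys) (Unique.++⁺ uw uy disjoint) (All.++⁺ (All.map proj₁ aw) (All.map proj₁ ay)))
  where
  disjoint : Disjoint ws ys
  disjoint (i , j) = proj₂ (All.lookup aw i) (proj₂ (All.lookup ay j))

deficit-split : ∀ n a b c w → c + w ≡ a → w + b ≤ n → n ∸ c ≤ (n ∸ a) + (n ∸ b)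
deficit-split n a b c w c+w≡a w+b≤n = begin
  n ∸ c             ≤⟨ m≤n+o⇒m∸n≤o n c n≤c+w+[n∸a] ⟩
  w + (n ∸ a)       ≤⟨ +-monoˡ-≤ (n ∸ a) (m+n≤o⇒m≤o∸n w w+b≤n) ⟩
  (n ∸ b) + (n ∸ a) ≡⟨ +-comm (n ∸ b) (n ∸ a) ⟩
  (n ∸ a) + (n ∸ b) ∎
  where
  open ≤-Reasoning
  n≤c+w+[n∸a] : n ≤ c + (w + (n ∸ a))
  n≤c+w+[n∸a] = begin
    n                 ≤⟨ m≤n+m∸n n a ⟩
    a + (n ∸ a)       ≡⟨ cong (_+ (n ∸ a)) (sym c+w≡a) ⟩
    c + w + (n ∸ a)   ≡⟨ +-assoc c w (n ∸ a) ⟩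
    c + (w + (n ∸ a)) ∎

sum-of-halves : ∀ n m x y → x * (m + m) ≤ n → y * (m + m) ≤ n → (x + y) * m ≤ n
sum-of-halves n m x y x[2m]≤n y[2m]≤n =
  subst (_≤ n) (sym (*-distribʳ-+ m x y)) (both (≤-total (x * m) (y * m)))
  where
  both : (x * m ≤ y * m) ⊎ (y * m ≤ x * m) → x * m + y * m ≤ n
  both (inj₁ xm≤ym) = ≤-trans (+-monoˡ-≤ (y * m) xm≤ym) (subst (_≤ n) (*-distribˡ-+ y m m) y[2m]≤n)
  both (inj₂ ym≤xm) = ≤-trans (+-monoʳ-≤ (x * m) ym≤xm) (subst (_≤ n) (*-distribˡ-+ x m m) x[2m]≤n)

LargeBelow : (ℕ → Set) → ℕ → ℕ → Set
LargeBelow P k n =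
  Σ (List ℕ) λ xs → Unique xs × All (λ m → m < n × P m) xs × ((n ∸ length xs) * suc k ≤ n)

large-mono : ∀ {P Q : ℕ → Set} {k n} → (∀ m → P m → Q m) → LargeBelow P k n → LargeBelow Q k n
large-mono P⇒Q (xs , u , xs∈P , deficit) = xs , u , All.map (λ (m<n , Pm) → m<n , P⇒Q _ Pm) xs∈P , deficit

-- Keeping the members in Q of a witness list for P: the deficits of P and Q add
-- up, so two 1/(2(k+1)) bounds give a 1/(k+1) bound for P ∩ Q.
large-∩ : ∀ {P Q : ℕ → Set} {k n} → Decidable Q →
          LargeBelow P (k + suc k) n → LargeBelow Q (k + suc k) n → LargeBelow (λ m → P m × Q m) k n
large-∩ {P} {Q} {k} {n} Q? (xs , uxs , xs∈P , deficitP) (ys , uys , ys∈Q , deficitQ) =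
  filter Q? xs , Unique.filter⁺ Q? uxs , kept∈P∩Q , deficit
  where
  ¬Q? : Decidable (λ m → ¬ Q m)
  ¬Q? = ¬? ∘ Q?
  kept∈P∩Q : All (λ m → m < n × P m × Q m) (filter Q? xs)
  kept∈P∩Q = All.zipWith (λ ((m<n , Pm) , Qm) → m<n , Pm , Qm) (All.filter⁺ Q? xs∈P , All.all-filter Q? xs)
  dropped∉Q : All (λ m → m < n × ¬ Q m) (filter ¬Q? xs)
  dropped∉Q = All.zipWith (λ ((m<n , _) , ¬Qm) → m<n , ¬Qm) (All.filter⁺ ¬Q? xs∈P , All.all-filter ¬Q? xs)
  dropped+ys≤n : length (filter ¬Q? xs) + length ys ≤ n
  dropped+ys≤n = separated-length n _ ys (Unique.filter⁺ ¬Q? uxs) uys dropped∉Q ys∈Q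
  deficit : (n ∸ length (filter Q? xs)) * suc k ≤ n
  deficit = ≤-trans
    (*-monoˡ-≤ (suc k) (deficit-split n (length xs) (length ys) _ _ (length-filter-split Q? xs) dropped+ys≤n))
    (sum-of-halves n (suc k) (n ∸ length xs) (n ∸ length ys) deficitP deficitQ)

density1-mono : ∀ {P Q : ℕ → Set} → (∀ m → P m → Q m) → Density1 P → Density1 Q
density1-mono P⇒Q dP k with dP k
... | N , large = N , λ n N≤n → large-mono P⇒Q (large n N≤n)

-- Density-1 predicates are closed under intersection (one of them decidable):
-- beyond both thresholds for accuracy 2(k+1), accuracy k+1 holds for P ∩ Q.
density1-∩ : ∀ {P Q : ℕ → Set} → Decidable Q → Density1 P → Density1 Q → Density1 (λ m → P m × Q m)
density1-∩ Q? dP dQ k with dP (k + suc k) | dQ (k + suc k)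
... | NP , largeP | NQ , largeQ = NP ⊔ NQ , λ n N≤n →
  large-∩ Q? (largeP n (≤-trans (m≤m⊔n NP NQ) N≤n)) (largeQ n (≤-trans (m≤n⊔m NP NQ) N≤n))

least-true : (p : ℕ → Bool) (l : ℕ) → p l ≡ true →
             Σ ℕ λ l₀ → (p l₀ ≡ true) × (∀ m → m < l₀ → p m ≡ false)
least-true p zero pl = zero , pl , λ _ ()
least-true p (suc l) pl with p zero in p0
... | true = zero , p0 , λ _ ()
... | false with least-true (p ∘ suc) l pl
...   | l₀ , pl₀ , below = suc l₀ , pl₀ , λ { zero _ → p0 ; (suc m) (s≤s m<l₀) → below m m<l₀ }

-- Programs for addition,
-- triangular numbers and Cantor pairing assemble the query code ⟨n,1,l⟩;
-- 'missing' returns 0 exactly when that code is in the oracle, and 'search'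
-- minimises over l and outputs 1 (discarding the witness found).

plusP : PR 2
plusP = prec (proj fz) (comp succ (proj (fs fz) ∷ []))

triP : PR 1
triP = prec zer (comp succ (comp plusP (proj fz ∷ proj (fs fz) ∷ []) ∷ []))

pairP : PR 2
pairP = comp plusP (comp triP (plusP ∷ []) ∷ proj (fs fz) ∷ [])

-- (l , n) ↦ ⟨n,1,l⟩
positiveCodeP : PR 2
positiveCodeP = comp pairP (proj (fs fz) ∷ comp pairP (comp succ (zer ∷ []) ∷ proj fz ∷ []) ∷ [])

isZeroP : PR 1
isZeroP = prec (comp succ (zer ∷ [])) zer

missingP : PR 2
missingP = comp isZeroP (comp orc (positiveCodeP ∷ []) ∷ [])

search : TuringFunctional
search = comp succ (comp zer (mu missingP ∷ []) ∷ [])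

isZero : ℕ → ℕ
isZero zero    = 1
isZero (suc _) = 0

module _ {X : ℕ → Bool} where

  eval-plus : ∀ a b → Eval X plusP (a ∷ b ∷ []) (a + b)
  eval-plus zero    b = ev-prec0 ev-proj
  eval-plus (suc a) b = ev-precS (eval-plus a b) (ev-comp (evv-cons ev-proj evv-nil) ev-succ)

  plus-output : ∀ {a b v} → Eval X plusP (a ∷ b ∷ []) v → v ≡ a + b
  plus-output (ev-prec0 ev-proj) = refl
  plus-output (ev-precS e (ev-comp (evv-cons ev-proj evv-nil) ev-succ)) = cong suc (plus-output e)

  eval-tri : ∀ n → Eval X triP (n ∷ []) (tri n)
  eval-tri zero    = ev-prec0 ev-zer
  eval-tri (suc n) = ev-precS (eval-tri n)
    (ev-comp (evv-cons (ev-comp (evv-cons ev-proj (evv-cons ev-proj evv-nil)) (eval-plus n (tri n))) evv-nil) ev-succ)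

  tri-output : ∀ {n v} → Eval X triP (n ∷ []) v → v ≡ tri n
  tri-output (ev-prec0 ev-zer) = refl
  tri-output (ev-precS e (ev-comp (evv-cons (ev-comp (evv-cons ev-proj (evv-cons ev-proj evv-nil)) e+) evv-nil) ev-succ))
    rewrite plus-output e+ | tri-output e = refl

  eval-pair : ∀ a b → Eval X pairP (a ∷ b ∷ []) (pair a b)
  eval-pair a b = ev-comp (evv-cons (ev-comp (evv-cons (eval-plus a b) evv-nil) (eval-tri (a + b)))
                                    (evv-cons ev-proj evv-nil))
                          (eval-plus (tri (a + b)) b)

  pair-output : ∀ {a b v} → Eval X pairP (a ∷ b ∷ []) v → v ≡ pair a b
  pair-output (ev-comp (evv-cons (ev-comp (evv-cons e+ evv-nil) etri) (evv-cons ev-proj evv-nil)) e+′)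
    rewrite plus-output e+′ | tri-output etri | plus-output e+ = refl

  eval-positiveCode : ∀ l n → Eval X positiveCodeP (l ∷ n ∷ []) (triple n 1 l)
  eval-positiveCode l n = ev-comp
    (evv-cons ev-proj (evv-cons (ev-comp (evv-cons (ev-comp (evv-cons ev-zer evv-nil) ev-succ)
                                                   (evv-cons ev-proj evv-nil))
                                         (eval-pair 1 l))
                                evv-nil))
    (eval-pair n (pair 1 l))

  positiveCode-output : ∀ {l n v} → Eval X positiveCodeP (l ∷ n ∷ []) v → v ≡ triple n 1 l
  positiveCode-output (ev-comp (evv-cons ev-proj (evv-cons (ev-comp (evv-cons (ev-comp (evv-cons ev-zer evv-nil) ev-succ)
                                                                             (evv-cons ev-proj evv-nil))
                                                                   e1l)
                                                          evv-nil))
                               en)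
    rewrite pair-output en | pair-output e1l = refl

  eval-isZero : ∀ m → Eval X isZeroP (m ∷ []) (isZero m)
  eval-isZero zero    = ev-prec0 (ev-comp (evv-cons ev-zer evv-nil) ev-succ)
  eval-isZero (suc m) = ev-precS (eval-isZero m) ev-zer

  eval-missing : ∀ l n → Eval X missingP (l ∷ n ∷ []) (isZero (bit (X (triple n 1 l))))
  eval-missing l n = ev-comp (evv-cons (ev-comp (evv-cons (eval-positiveCode l n) evv-nil) ev-orc) evv-nil)
                             (eval-isZero _)

  isZero-output-0 : ∀ {m} → Eval X isZeroP (m ∷ []) 0 → 0 < m
  isZero-output-0 (ev-precS _ ev-zer) = s≤s z≤n
  isZero-output-0 (ev-prec0 (ev-comp (evv-cons ev-zer evv-nil) ()))

  missing-output-0 : ∀ {l n} → Eval X missingP (l ∷ n ∷ []) 0 → triple n 1 l ∈R X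
  missing-output-0 (ev-comp (evv-cons (ev-comp (evv-cons ecode evv-nil) ev-orc) evv-nil) eisZero)
    with refl ← positiveCode-output ecode = bit-positive (X _) (isZero-output-0 eisZero)
    where
    bit-positive : ∀ b → 0 < bit b → b ≡ true
    bit-positive true _ = refl

  search-halts : ∀ n → (Σ ℕ λ l → triple n 1 l ∈R X) → search ^ X ⟨ n ⟩≃ 1
  search-halts n (l , hit) with least-true (λ m → X (triple n 1 m)) l hit
  ... | l₀ , hit₀ , miss = ev-comp (evv-cons (ev-comp (evv-cons (ev-mu found earlier) evv-nil) ev-zer) evv-nil) ev-succ
    where
    found : Eval X missingP (l₀ ∷ n ∷ []) 0
    found = subst (Eval X missingP (l₀ ∷ n ∷ [])) (cong (isZero ∘ bit) hit₀) (eval-missing l₀ n)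
    earlier : ∀ m → m < l₀ → Σ ℕ λ v → Eval X missingP (m ∷ n ∷ []) (suc v)
    earlier m m<l₀ = 0 , subst (Eval X missingP (m ∷ n ∷ [])) (cong (isZero ∘ bit) (miss m m<l₀)) (eval-missing m n)

  search-output : ∀ {n v} → search ^ X ⟨ n ⟩≃ v → v ≡ 1 × Σ ℕ λ l → triple n 1 l ∈R X
  search-output (ev-comp (evv-cons (ev-comp (evv-cons (ev-mu {n = l} found _) evv-nil) ev-zer) evv-nil) ev-succ) =
    refl , l , missing-output-0 found

positive-entry : ∀ {C O n} → PartialOracle C O → n ∈R C → Dom O n → Σ ℕ λ l → triple n 1 l ∈R O
positive-entry {n = n} (_ , says-out , _) n∈C (zero , l , entry) =
  contradiction (trans (sym (says-out n l entry)) n∈C) λ ()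
positive-entry _ _ (suc zero , l , entry) = l , entry
positive-entry {n = n} (bits , _) _ (suc (suc x) , l , entry) with bits n (suc (suc x)) l entry
... | s≤s ()

-- The search reduces A to B: it halts on B ∩ dom(O), which is density-1, and
-- it answers 1 only on members of B ⊆ A.
mainTheorem15 : (A B : Real) → Density1Real A → Density1Real B → B ⊆R A → B ≥g A
mainTheorem15 A B _ dB B⊆A = search , λ O O-generic → halts-densely O O-generic , agrees O (proj₁ O-generic)
  where
  halts-densely : ∀ O → GenericOracle B O → Density1 (λ n → Σ ℕ λ v → search ^ O ⟨ n ⟩≃ v)
  halts-densely O (partial , dom-dense) =
    density1-mono (λ n (n∈dom , n∈B) → 1 , search-halts n (positive-entry {O = O} partial n∈B n∈dom))
                  (density1-∩ (λ n → B n ≟B true) dom-dense dB)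
  agrees : ∀ O → PartialOracle B O → ∀ n v → search ^ O ⟨ n ⟩≃ v → v ≡ bit (A n)
  agrees O (_ , _ , says-in) n v run with search-output run
  ... | refl , l , entry rewrite B⊆A n (says-in n l entry) = refl
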